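{- Let $n_1,\dots,n_r$ be positive integers and let $W=W(n_1,\dots,n_r)$ be the binary word whose consecutive runs have lengths $n_1,\dots,n_r$, the first run being a $\mathtt1$-run (so runs alternate $\mathtt1,\mathtt0,\mathtt1,\dots$). If $n_1$ is odd and $n_2>n_3>\cdots>n_r$, then $W$ is not a shuffle square.
   Context: A run of a word is a maximal block of consecutive equal letters. A word $W$ is a shuffle square if its positions can be partitioned into the supports of two subsequences that are equal as words. -}

module Defs where

open import Data.Bool using (Bool; true; false; not)
open import Data.Nat using (ℕ)
open import Data.List using (List; []; _∷_; _++_; replicate; length)
open import Data.Product using (Σ; _×_)
open import Relation.Binary.PropositionalEquality using (_≡_)

-- Binary words: true = letter 1, false = letter 0.
Word : Set
Word = List Bool

runWord : Bool → List ℕ → Word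
runWord b []       = []
runWord b (n ∷ ns) = replicate n b ++ runWord (not b) ns

W : List ℕ → Word
W = runWord true

-- A partition of the positions of w into two classes is a colouring
-- c : List Bool with length c ≡ length w.  select b c w is the subsequence
-- of w supported on the positions i with c[i] = b.
select : Bool → List Bool → Word → Word
select b []           _        = []
select b (_ ∷ _)      []       = []
select true  (true  ∷ c) (a ∷ w) = a ∷ select true c w
select true  (false ∷ c) (a ∷ w) = select true c w
select false (true  ∷ c) (a ∷ w) = select false c w
select false (false ∷ c) (a ∷ w) = a ∷ select false c w

IsShuffleSquare : Word → Set
IsShuffleSquare w =
  Σ (List Bool) λ c → (length c ≡ length w) × (select true c w ≡ select false c w)

{-# OPTIONS --safe #-}
module Submission where

open import Defs
open import Data.Bool using (Bool; true; false; not)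
open import Data.Bool.Properties using (not-¬; not-involutive)
open import Data.Empty using (⊥-elim)
open import Data.List using (List; []; _∷_; _++_; [_]; replicate; length)
open import Data.List.Properties using (++-assoc; ++-identityʳ; ++-conicalˡ; ++-conicalʳ; ∷-injective)
open import Data.List.Relation.Unary.All using (All; _∷_)
open import Data.List.Relation.Unary.Linked using (Linked; _∷_)
open import Data.Nat using (ℕ; zero; suc; _+_; _*_; _>_; _<_; _≤_; _≤‴_; ≤‴-refl; ≤‴-step; s≤s)
open import Data.Nat.Properties using (+-suc; +-identityʳ; suc-injective; <⇒≤; ≤-refl; n≤1+n; ≤⇒≤‴)
open import Data.Nat.Divisibility using (_∣_; divides)
open import Data.Product using (∃; ∃₂; _×_; _,_)
open import Data.Sum using (_⊎_; inj₁; inj₂; map₂)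
open import Function using (_∘_)
open import Relation.Nullary using (¬_)
open import Relation.Binary.PropositionalEquality using (_≡_; _≢_; refl; sym; trans; cong; subst)

-- Read W from left to right, sending each letter to one of the two subsequences,
-- and keep the queue of letters by which the leading subsequence is ahead.  Each
-- letter is either appended to the queue or pops its head, and a shuffle square
-- takes the empty queue to the empty queue.  The first run has odd length, so it
-- leaves a nonempty queue of 1s.  Before every later run of n letters b, the queue
-- either begins with the other letter, and then all n b's are appended, or it
-- contains a run longer than n, and then n pops cannot destroy it without the
-- queue coming to begin with b.  In both cases the queue afterwards begins with b
-- or contains a run of length n, which is longer than the next run; so the queue
-- is never empty at the end.


-- A letter given to side s is pushed onto d; one given to the other side pops the
-- head of d or, if d is empty, makes it [ a ] with the roles of the sides swapped.
Ahead : Bool → Word → List Bool → Word → Set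
Ahead s d c w = d ++ select s c w ≡ select (not s) c w

data Step (a : Bool) : Word → Word → Set where
  push : ∀ {d} → Step a d (d ++ [ a ])
  pop  : ∀ {d} → Step a (a ∷ d) d

data Steps : Word → Word → Word → Set where
  []  : ∀ {d} → Steps d [] d
  _∷_ : ∀ {a d d′ w e} → Step a d d′ → Steps d′ w e → Steps d (a ∷ w) e

ahead-∷ : ∀ s {d} x {c} a {w} → Ahead s d (x ∷ c) (a ∷ w) →
          ∃₂ λ s′ d′ → Step a d d′ × Ahead s′ d′ c w
ahead-∷ true  {d}     true  a ahead = true , d ++ [ a ] , push , trans (++-assoc d [ a ] _) ahead
ahead-∷ false {d}     false a ahead = false , d ++ [ a ] , push , trans (++-assoc d [ a ] _) ahead
ahead-∷ true  {[]}    false a ahead = false , [ a ] , push , sym ahead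
ahead-∷ false {[]}    true  a ahead = true , [ a ] , push , sym ahead
ahead-∷ true  {_ ∷ d} false a ahead with refl , ahead′ ← ∷-injective ahead = true , d , pop , ahead′
ahead-∷ false {_ ∷ d} true  a ahead with refl , ahead′ ← ∷-injective ahead = false , d , pop , ahead′

ahead⇒steps : ∀ s {d} c w → length c ≡ length w → Ahead s d c w → Steps d w []
ahead⇒steps s {d} []      []      _   ahead with refl ← ++-conicalˡ d [] ahead = []
ahead⇒steps s     (x ∷ c) (a ∷ w) len ahead with s′ , d′ , step , ahead′ ← ahead-∷ s x a ahead =
  step ∷ ahead⇒steps s′ c w (suc-injective len) ahead′

shuffleSquare⇒steps : ∀ {w} → IsShuffleSquare w → Steps [] w []
shuffleSquare⇒steps {w} (c , len , square) = ahead⇒steps true c w len square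

steps-++ : ∀ u {v d e} → Steps d (u ++ v) e → ∃ λ m → Steps d u m × Steps m v e
steps-++ []      steps          = _ , [] , steps
steps-++ (_ ∷ u) (step ∷ steps) with m , first , rest ← steps-++ u steps = m , step ∷ first , rest

BeginsWith : ℕ → Bool → Word → Set
BeginsWith k x d = ∃ λ q → d ≡ replicate k x ++ q

ContainsRun : ℕ → Word → Set
ContainsRun k d = ∃₂ λ p x → ∃ λ q → d ≡ p ++ replicate k x ++ q

containsRun-pred : ∀ {k d} → ContainsRun (suc k) d → ContainsRun k d
containsRun-pred (p , x , q , refl) = p ++ [ x ] , x , q , sym (++-assoc p [ x ] _)

containsRun-≤ : ∀ {k l d} → k ≤ l → ContainsRun l d → ContainsRun k d
containsRun-≤ {d = d} = go ∘ ≤⇒≤‴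
  where
  go : ∀ {k l} → k ≤‴ l → ContainsRun l d → ContainsRun k d
  go ≤‴-refl        run = run
  go (≤‴-step k<‴l) run = containsRun-pred (go k<‴l run)

replicate-∷ʳ : ∀ {A : Set} n (x : A) → replicate n x ++ [ x ] ≡ replicate (suc n) x
replicate-∷ʳ zero    x = refl
replicate-∷ʳ (suc n) x = cong (x ∷_) (replicate-∷ʳ n x)

-- t * 2 rather than 2 * t, so that suc t * 2 reduces to suc (suc (t * 2)).
steps-parity : ∀ {b e} j m → Steps (replicate j b) (replicate m b) e →
               ∃ λ k → e ≡ replicate k b × ∃ λ t → j + m ≡ t * 2 + k
steps-parity j       zero    []              = j , refl , 0 , +-identityʳ j
steps-parity (suc j) (suc m) (pop ∷ steps)
  with k , e≡ , t , eq ← steps-parity j m steps =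
  k , e≡ , suc t , cong suc (trans (+-suc j m) (cong suc eq))
steps-parity {b} j (suc m) (push ∷ steps)
  with k , e≡ , t , eq ← steps-parity (suc j) m (subst (λ d → Steps d _ _) (replicate-∷ʳ j b) steps) =
  k , e≡ , t , trans (+-suc j m) eq

steps-oddBlock : ∀ {b e} n → ¬ 2 ∣ n → Steps [] (replicate n b) e → BeginsWith 1 b e
steps-oddBlock n odd steps with steps-parity 0 n steps
... | zero  , _    , t , eq = ⊥-elim (odd (divides t (trans eq (+-identityʳ _))))
... | suc k , refl , _     = replicate k _ , refl

steps-pushOnly : ∀ {x b p e} m → x ≢ b → Steps (x ∷ p) (replicate m b) e →
                 e ≡ (x ∷ p) ++ replicate m b
steps-pushOnly             zero    _   []             = sym (++-identityʳ _)
steps-pushOnly {x} {b} {p} (suc m) x≢b (push ∷ steps) =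
  trans (steps-pushOnly m x≢b steps) (++-assoc (x ∷ p) [ b ] (replicate m b))
steps-pushOnly             (suc m) x≢b (pop ∷ _)      = ⊥-elim (x≢b refl)

steps-beginsWith : ∀ {b d e} j m → m < j → BeginsWith j b d → Steps d (replicate m b) e → BeginsWith 1 b e
steps-beginsWith {b} (suc j) zero    _         (q , refl) []             = replicate j b ++ q , refl
steps-beginsWith     (suc j) (suc m) (s≤s m<j) (q , refl) (pop ∷ steps)  = steps-beginsWith j m m<j (q , refl) steps
steps-beginsWith {b} (suc j) (suc m) m<j       (q , refl) (push ∷ steps) =
  steps-beginsWith (suc j) m (<⇒≤ m<j) (q ++ [ b ] , ++-assoc (replicate (suc j) b) q [ b ]) steps

step-containsRun : ∀ {a d d′} k → Step a d d′ → ContainsRun (suc k) d →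
                   BeginsWith k a d′ ⊎ ContainsRun (suc k) d′
step-containsRun {a} k push (p , x , q , refl) =
  inj₂ (p , x , q ++ [ a ] ,
        trans (++-assoc p _ [ a ]) (cong (p ++_) (++-assoc (replicate (suc k) x) q [ a ])))
step-containsRun k pop ([]    , _ , q , refl) = inj₁ (q , refl)
step-containsRun k pop (_ ∷ p , x , q , refl) = inj₂ (p , x , q , refl)

steps-containsRun : ∀ {b n d e} m → m ≤ n → ContainsRun (suc n) d → Steps d (replicate m b) e →
                    BeginsWith 1 b e ⊎ ContainsRun (suc n) e
steps-containsRun         zero    _   run []             = inj₂ run
steps-containsRun {n = n} (suc m) m<n run (step ∷ steps) with step-containsRun n step run
... | inj₁ front = inj₁ (steps-beginsWith n m m<n front steps)
... | inj₂ run′  = steps-containsRun m (<⇒≤ m<n) run′ steps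

Primed : Bool → ℕ → Word → Set
Primed b n d = BeginsWith 1 (not b) d ⊎ ContainsRun (suc n) d

steps-block : ∀ {d e} b n → Primed b n d → Steps d (replicate n b) e → BeginsWith 1 b e ⊎ ContainsRun n e
steps-block b n (inj₁ (p , refl)) steps =
  inj₂ (not b ∷ p , b , [] , trans (steps-pushOnly n (not-¬ refl ∘ sym) steps)
                                   (cong ((not b ∷ p) ++_) (sym (++-identityʳ _))))
steps-block b n (inj₂ run) steps = map₂ (containsRun-≤ (n≤1+n n)) (steps-containsRun n ≤-refl run steps)

primed-next : ∀ {b n n′ d} → n > n′ → BeginsWith 1 b d ⊎ ContainsRun n d → Primed (not b) n′ d
primed-next {b} _    (inj₁ front) = inj₁ (subst (λ x → BeginsWith 1 x _) (sym (not-involutive b)) front)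
primed-next     n>n′ (inj₂ run)   = inj₂ (containsRun-≤ n>n′ run)

nonempty : ∀ {b n e} → n > 0 → BeginsWith 1 b e ⊎ ContainsRun n e → e ≢ []
nonempty _ (inj₁ (_ , refl)) ()
nonempty {n = suc _} _ (inj₂ (p , _ , _ , refl)) e≡[] with () ← ++-conicalʳ p _ e≡[]

steps-runWord : ∀ {d e} b n ns → All (_> 0) (n ∷ ns) → Linked _>_ (n ∷ ns) → Primed b n d →
                Steps d (runWord b (n ∷ ns)) e → e ≢ []
steps-runWord b n [] (n>0 ∷ _) _ primed steps with _ , block , [] ← steps-++ (replicate n b) steps =
  nonempty n>0 (steps-block b n primed block)
steps-runWord b n (n′ ∷ ns) (_ ∷ positive) (n>n′ ∷ decreasing) primed steps
  with _ , block , rest ← steps-++ (replicate n b) steps =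
  steps-runWord (not b) n′ ns positive decreasing (primed-next n>n′ (steps-block b n primed block)) rest

claim5p2 : (n₁ : ℕ) → (ns : List ℕ) →
    All (λ k → k > 0) (n₁ ∷ ns) → ¬ (2 ∣ n₁) → Linked _>_ ns →
    ¬ IsShuffleSquare (W (n₁ ∷ ns))
claim5p2 n₁ [] _ odd _ square
  with _ , first , [] ← steps-++ (replicate n₁ true) (shuffleSquare⇒steps square)
  with _ , () ← steps-oddBlock n₁ odd first
claim5p2 n₁ (n₂ ∷ ns) (_ ∷ positive) odd decreasing square
  with _ , first , rest ← steps-++ (replicate n₁ true) (shuffleSquare⇒steps square) =
  steps-runWord false n₂ ns positive decreasing (inj₁ (steps-oddBlock n₁ odd first)) rest refl
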